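{- Let $n\ge1$, let $\sigma\in\mathcal{S}_n$ be a cycle of length $n$, and let $l$ be a positive integer with $\gcd(l,n)=1$. Then all solutions $\xi\in\mathcal{S}_n$ of $\sigma\xi=\xi\sigma^l$ lie in a single $\sigma$-equivalence class; i.e. the equation has a unique solution up to $\sigma$-equivalence.
   Context: $\mathbb{N}$ is the set of nonnegative integers. $\mathcal{S}_n$ is the symmetric group on $[n]=\{1,\dots,n\}$, with products composed left to right: $(\alpha\beta)(i)=\beta(\alpha(i))$. Two elements $\alpha,\beta\in\mathcal{S}_n$ are $\sigma$-equivalent if $\sigma^k\alpha=\beta\sigma^l$ for some $k,l\in\mathbb{N}$. -}

module Defs where

open import Data.Nat using (ℕ; zero; suc)
open import Data.Fin using (Fin)
open import Data.Product using (∃; ∃-syntax; _×_)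
open import Relation.Binary.PropositionalEquality using (_≡_)
open import Data.Fin.Permutation using (Permutation′; id; _∘ₚ_; _⟨$⟩ʳ_; _≈_)

-- Products compose left to right: (α β)(i) = β(α(i)).
-- stdlib's  α ∘ₚ β  applies α first, then β, so it is exactly the paper's αβ.

_^ₚ_ : ∀ {n} → Permutation′ n → ℕ → Permutation′ n
σ ^ₚ zero  = id
σ ^ₚ suc k = σ ∘ₚ (σ ^ₚ k)

IsFullCycle : ∀ {n} → Permutation′ n → Set
IsFullCycle {n} σ = ∀ (i j : Fin n) → ∃[ k ] ((σ ^ₚ k) ⟨$⟩ʳ i ≡ j)

SigmaEquiv : ∀ {n} → Permutation′ n → Permutation′ n → Permutation′ n → Set
SigmaEquiv σ α β = ∃[ k ] ∃[ l ] (((σ ^ₚ k) ∘ₚ α) ≈ (β ∘ₚ (σ ^ₚ l)))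

module Submission where

open import Defs
open import Data.Nat using (ℕ; _≥_; _>_; zero; suc)
open import Data.Nat.GCD using (gcd)
open import Data.Fin using (Fin)
open import Data.Product using (_,_)
open import Relation.Binary.PropositionalEquality using (_≡_; refl; sym; trans; cong; module ≡-Reasoning)
open import Data.Fin.Permutation using (Permutation′; _∘ₚ_; _≈_; _⟨$⟩ʳ_)

-- A solution of σ ξ = ξ σ^l is a map intertwining σ with σ^l; since σ is
-- transitive, such a map is determined by its value at one point.  If ξ and η
-- are solutions, pick k with σ^k (η 0) = ξ 0: then η σ^k is again a solution
-- (σ^k commutes with σ^l) and agrees with ξ at 0, so ξ = η σ^k.  The
-- coprimality of l and n is needed only for the existence of solutions.

private
  variable
    n : ℕ

record Intertwines (α σ τ : Permutation′ n) : Set where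
  constructor intertwining
  field commute : (σ ∘ₚ α) ≈ (α ∘ₚ τ)

open Intertwines

intertwines-^ₚ : {α σ τ : Permutation′ n} → Intertwines α σ τ →
  ∀ m → Intertwines α (σ ^ₚ m) (τ ^ₚ m)
intertwines-^ₚ h zero    = intertwining λ _ → refl
intertwines-^ₚ {α = α} {σ} {τ} h (suc m) = intertwining λ x → begin
  α ⟨$⟩ʳ ((σ ^ₚ m) ⟨$⟩ʳ (σ ⟨$⟩ʳ x))  ≡⟨ commute (intertwines-^ₚ h m) (σ ⟨$⟩ʳ x) ⟩
  (τ ^ₚ m) ⟨$⟩ʳ (α ⟨$⟩ʳ (σ ⟨$⟩ʳ x))  ≡⟨ cong ((τ ^ₚ m) ⟨$⟩ʳ_) (commute h x) ⟩
  (τ ^ₚ m) ⟨$⟩ʳ (τ ⟨$⟩ʳ (α ⟨$⟩ʳ x))  ∎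
  where open ≡-Reasoning

intertwines-∘ₚ : {α β σ τ υ : Permutation′ n} →
  Intertwines α σ τ → Intertwines β τ υ → Intertwines (α ∘ₚ β) σ υ
intertwines-∘ₚ {β = β} hα hβ =
  intertwining λ x → trans (cong (β ⟨$⟩ʳ_) (commute hα x)) (commute hβ _)

^ₚ-commutes : (σ : Permutation′ n) → ∀ k → Intertwines (σ ^ₚ k) σ σ
^ₚ-commutes σ zero    = intertwining λ _ → refl
^ₚ-commutes σ (suc k) = intertwining λ x → commute (^ₚ-commutes σ k) (σ ⟨$⟩ʳ x)

^ₚ-commutes-^ₚ : (σ : Permutation′ n) → ∀ k l → Intertwines (σ ^ₚ k) (σ ^ₚ l) (σ ^ₚ l)
^ₚ-commutes-^ₚ σ k = intertwines-^ₚ (^ₚ-commutes σ k)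

intertwiners-agree : {α β σ τ : Permutation′ n} → IsFullCycle σ →
  Intertwines α σ τ → Intertwines β σ τ →
  ∀ i₀ → α ⟨$⟩ʳ i₀ ≡ β ⟨$⟩ʳ i₀ → α ≈ β
intertwiners-agree {α = α} {β} {σ} {τ} full hα hβ i₀ e i with full i₀ i
... | m , refl = begin
  α ⟨$⟩ʳ ((σ ^ₚ m) ⟨$⟩ʳ i₀)  ≡⟨ commute (intertwines-^ₚ hα m) i₀ ⟩
  (τ ^ₚ m) ⟨$⟩ʳ (α ⟨$⟩ʳ i₀)  ≡⟨ cong ((τ ^ₚ m) ⟨$⟩ʳ_) e ⟩
  (τ ^ₚ m) ⟨$⟩ʳ (β ⟨$⟩ʳ i₀)  ≡⟨ sym (commute (intertwines-^ₚ hβ m) i₀) ⟩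
  β ⟨$⟩ʳ ((σ ^ₚ m) ⟨$⟩ʳ i₀)  ∎
  where open ≡-Reasoning

corollary3 : (n : ℕ) → n ≥ 1 → (σ : Permutation′ n) → IsFullCycle σ →
    (l : ℕ) → l > 0 → gcd l n ≡ 1 →
    (ξ η : Permutation′ n) →
    (σ ∘ₚ ξ) ≈ (ξ ∘ₚ (σ ^ₚ l)) → (σ ∘ₚ η) ≈ (η ∘ₚ (σ ^ₚ l)) →
    SigmaEquiv σ ξ η
corollary3 (suc n) _ σ full l _ _ ξ η hξ hη
  with full (η ⟨$⟩ʳ Fin.zero) (ξ ⟨$⟩ʳ Fin.zero)
... | k , ησᵏ0≡ξ0 =
  0 , k , intertwiners-agree {α = ξ} {η ∘ₚ (σ ^ₚ k)}
            full (intertwining hξ) hησᵏ Fin.zero (sym ησᵏ0≡ξ0)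
  where
  hησᵏ : Intertwines (η ∘ₚ (σ ^ₚ k)) σ (σ ^ₚ l)
  hησᵏ = intertwines-∘ₚ {α = η} (intertwining hη) (^ₚ-commutes-^ₚ σ k l)
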